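{- Let $d,r\in\mathbb Z$ with $d\ne0$, and let $b_{d,r}(n)=\sum_kh_{0,d,r}(n,k)$, where $h_{0,d,r}(0,0)=1$, $h_{0,d,r}(n,k)=0$ for $k<0$ or $k>n$, and $h_{0,d,r}(n,k)=(dk-r)h_{0,d,r}(n-1,k)+h_{0,d,r}(n-1,k-1)$ for $n\ge1$. Then $$\sum_{n=0}^\infty b_{d,r}(n)\frac{x^n}{n!}=\exp\!\left(\frac{e^{dx}-drx-1}{d}\right).$$ -}

module Defs where

open import Data.Nat as ℕ using (ℕ; zero; suc; _∸_; _!)
open import Data.Nat.Properties using (_!≢0)
import Data.Nat.Coprimality as Cop
open import Data.Integer as ℤ using (ℤ; +_; +[1+_]; -[1+_]; 0ℤ)
open import Data.Rational as ℚ using (ℚ; mkℚ; 0ℚ; 1ℚ; _/_; _+_; _*_; _-_; _÷_)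
open import Relation.Binary.PropositionalEquality using (_≡_; _≢_; refl)
open import Relation.Nullary using (contradiction)

-- The triangle h_{0,d,r}(n,k).  k ranges over ℕ; the paper's value
-- h(n,k)=0 for k<0 is built in: at k = 0 the term h(n-1,k-1) vanishes.
-- h(n,k) = 0 for k > n follows from the recursion (h 0 (suc k) = 0).

h₀ : (d r : ℤ) → ℕ → ℕ → ℤ
h₀ d r zero    zero    = ℤ.+ 1
h₀ d r zero    (suc k) = 0ℤ
h₀ d r (suc n) zero    = (d ℤ.* (+ 0) ℤ.- r) ℤ.* h₀ d r n zero
h₀ d r (suc n) (suc k) =
  (d ℤ.* (+ suc k) ℤ.- r) ℤ.* h₀ d r n (suc k) ℤ.+ h₀ d r n k

sumℤ : ℕ → (ℕ → ℤ) → ℤ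
sumℤ zero    f = f zero
sumℤ (suc m) f = sumℤ m f ℤ.+ f (suc m)

b : (d r : ℤ) → ℕ → ℤ
b d r n = sumℤ n (h₀ d r n)

Series : Set
Series = ℕ → ℚ

sumℚ : ℕ → (ℕ → ℚ) → ℚ
sumℚ zero    f = f zero
sumℚ (suc m) f = sumℚ m f + f (suc m)

const : ℚ → Series
const c zero    = c
const c (suc n) = 0ℚ

X : Series
X zero          = 0ℚ
X (suc zero)    = 1ℚ
X (suc (suc n)) = 0ℚ

_⊕_ : Series → Series → Series
(f ⊕ g) n = f n + g n

_⊖_ : Series → Series → Series
(f ⊖ g) n = f n - g n

_·_ : ℚ → Series → Series
(c · f) n = c * f n

_⊛_ : Series → Series → Series
(f ⊛ g) n = sumℚ n (λ i → f i * g (n ∸ i))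

pow : Series → ℕ → Series
pow f zero    = const 1ℚ
pow f (suc m) = f ⊛ pow f m

inv! : ℕ → ℚ
inv! m = ((+ 1) / (m !)) {{m !≢0}}

-- exp(G) = Σ_m G^m / m!  for a series G with G(0) = 0; then only the terms
-- m ≤ n contribute to the coefficient of x^n, so the sum is finite.
expS : Series → Series
expS G n = sumℚ n (λ m → inv! m * pow G m n)

expLin : ℤ → Series
expLin c n = ((c ℤ.^ n) / (n !)) {{n !≢0}}

fromℤ : ℤ → ℚ
fromℤ z = mkℚ z 0 (Cop.sym (Cop.1-coprimeTo _))

fromℤ-nonZero : ∀ d → d ≢ 0ℤ → ℚ.NonZero (fromℤ d)
fromℤ-nonZero (+ zero)  d≢0 = contradiction refl d≢0
fromℤ-nonZero +[1+ n ]  _   = _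
fromℤ-nonZero -[1+ n ]  _   = _

G : (d r : ℤ) → d ≢ 0ℤ → Series
G d r d≢0 n =
  ((expLin d ⊖ (fromℤ (d ℤ.* r) · X)) ⊖ const 1ℚ) n ÷ fromℤ d
  where instance _ = fromℤ-nonZero d d≢0

egf-b : (d r : ℤ) → Series
egf-b d r n = ((b d r n) / (n !)) {{n !≢0}}

-- Both sides are the unique power series f with f(0) = 1 and f′ = G′ f, where
-- G′ = e^{dx} − r.  For exp(G) this is the chain rule (G^m)′ = m G′ G^{m−1}.
-- For F = Σ b(n) xⁿ/n! split F into the columns U_k = Σ_n h(n,k) xⁿ/n!, which
-- satisfy U_k′ = (dk − r) U_k + U_{k−1}.  Uniqueness of solutions of this linear
-- equation gives (e^{dx} − 1) U_{k−1} = dk U_k, hence U_k′ = e^{dx} U_{k−1} − r U_k,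
-- and summing over k yields F′ = (e^{dx} − r) F.

module Submission where

open import Defs
open import Data.Nat using (ℕ)
open import Data.Integer using (ℤ; 0ℤ)
open import Relation.Binary.PropositionalEquality using (_≡_; _≢_)

open import Data.Nat as ℕ using (zero; suc; _∸_; _!; _≤_; _<_; z≤n; s≤s)
open import Data.Nat.Properties using (_!≢0)
import Data.Nat.Properties as ℕ
open import Data.Nat.Induction using (<-rec)
open import Data.Integer as ℤ using (+_)
import Data.Integer.Properties as ℤ
open import Data.Rational as ℚ using (ℚ; 0ℚ; 1ℚ; _+_; _*_; _-_; -_; _/_; 1/_)
import Data.Rational.Properties as ℚ
import Data.Rational.Unnormalised as ℚᵘ
import Data.Rational.Unnormalised.Properties as ℚᵘ
open import Function using (_∘_)
open import Relation.Binary.PropositionalEquality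
  using (refl; sym; trans; cong; cong₂; module ≡-Reasoning)
import Data.Integer.Solver as ℤ-Solver
import Data.Rational.Solver as ℚ-Solver
open import Algebra.Bundles using (CommutativeMonoid)
open import Algebra.Properties.CommutativeSemigroup
  (CommutativeMonoid.commutativeSemigroup ℚ.*-1-commutativeMonoid)
  using () renaming (x∙yz≈y∙xz to x*[y*z]≡y*[x*z])
open import Algebra.Properties.CommutativeSemigroup
  (CommutativeMonoid.commutativeSemigroup ℚ.+-0-commutativeMonoid)
  using () renaming (interchange to +-interchange)

open ≡-Reasoning

ι : ℤ → ℚ
ι = fromℤ

ιₙ : ℕ → ℚ
ιₙ n = ι (+ n)

ι-homo-+ : ∀ a b → ι (a ℤ.+ b) ≡ ι a + ι b
ι-homo-+ a b = ℚ.toℚᵘ-injective (ℚᵘ.≃-trans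
  (ℚᵘ.*≡* (solve 2 (λ a b → (a :+ b) :* (con (+ 1) :* con (+ 1))
                          := (a :* con (+ 1) :+ b :* con (+ 1)) :* con (+ 1)) refl a b))
  (ℚᵘ.≃-sym (ℚ.toℚᵘ-homo-+ (ι a) (ι b))))
  where open ℤ-Solver.+-*-Solver

ι-homo-* : ∀ a b → ι (a ℤ.* b) ≡ ι a * ι b
ι-homo-* a b = ℚ.toℚᵘ-injective (ℚᵘ.≃-trans
  (ℚᵘ.*≡* (solve 2 (λ a b → (a :* b) :* (con (+ 1) :* con (+ 1)) := (a :* b) :* con (+ 1)) refl a b))
  (ℚᵘ.≃-sym (ℚ.toℚᵘ-homo-* (ι a) (ι b))))
  where open ℤ-Solver.+-*-Solver

ι-homo‿- : ∀ a → ι (ℤ.- a) ≡ - ι a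
ι-homo‿- a = ℚ.toℚᵘ-injective (ℚᵘ.≃-sym (ℚ.toℚᵘ-homo‿- (ι a)))

ι-homo-- : ∀ a b → ι (a ℤ.- b) ≡ ι a - ι b
ι-homo-- a b = trans (ι-homo-+ a (ℤ.- b)) (cong (_+_ (ι a)) (ι-homo‿- b))

ιₙ-homo-+ : ∀ m n → ιₙ (m ℕ.+ n) ≡ ιₙ m + ιₙ n
ιₙ-homo-+ m n = trans (cong ι (ℤ.pos-+ m n)) (ι-homo-+ (+ m) (+ n))

ιₙ-homo-* : ∀ m n → ιₙ (m ℕ.* n) ≡ ιₙ m * ιₙ n
ιₙ-homo-* m n = trans (cong ι (ℤ.pos-* m n)) (ι-homo-* (+ m) (+ n))

ιₙ-suc : ∀ n → ιₙ (suc n) ≡ 1ℚ + ιₙ n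
ιₙ-suc = ιₙ-homo-+ 1

ι-sumℤ : ∀ m f → ι (sumℤ m f) ≡ sumℚ m (λ k → ι (f k))
ι-sumℤ zero    f = refl
ι-sumℤ (suc m) f =
  trans (ι-homo-+ (sumℤ m f) (f (suc m))) (cong (_+ ι (f (suc m))) (ι-sumℤ m f))

ιₙ-nonZero : ∀ m .{{_ : ℕ.NonZero m}} → ℚ.NonZero (ιₙ m)
ιₙ-nonZero (suc m) = _

*-cancelˡ : ∀ c .{{_ : ℚ.NonZero c}} {p q} → c * p ≡ c * q → p ≡ q
*-cancelˡ c {p} {q} eq = trans (sym (1/c*[c*x]≡x p)) (trans (cong (1/ c *_) eq) (1/c*[c*x]≡x q))
  where
  1/c*[c*x]≡x : ∀ x → 1/ c * (c * x) ≡ x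
  1/c*[c*x]≡x x = begin
    1/ c * (c * x)  ≡⟨ sym (ℚ.*-assoc (1/ c) c x) ⟩
    1/ c * c * x    ≡⟨ cong (_* x) (ℚ.*-inverseˡ c) ⟩
    1ℚ * x          ≡⟨ ℚ.*-identityˡ x ⟩
    x               ∎

-- The denominator of the ℚᵘ product below is 1 * suc m, which reduces to suc (m + 0).
ιₙ-*-/ : ∀ z m .{{_ : ℕ.NonZero m}} → ιₙ m * (z / m) ≡ ι z
ιₙ-*-/ z (suc m) = ℚ.toℚᵘ-injective (ℚᵘ.≃-trans
  (ℚ.toℚᵘ-homo-* (ιₙ (suc m)) (z / suc m))
  (ℚᵘ.≃-trans (ℚᵘ.*-congˡ {ℚ.toℚᵘ (ιₙ (suc m))} (ℚ.toℚᵘ-fromℚᵘ (ℚᵘ.mkℚᵘ z m)))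
              (ℚᵘ.*≡* (begin
                 + suc m ℤ.* z ℤ.* + 1   ≡⟨ solve 2 (λ k z → k :* z :* con (+ 1) := z :* k)
                                                    refl (+ suc m) z ⟩
                 z ℤ.* + suc m           ≡⟨ cong (λ k → z ℤ.* + suc k) (sym (ℕ.+-identityʳ m)) ⟩
                 z ℤ.* + suc (m ℕ.+ 0)   ∎))))
  where open ℤ-Solver.+-*-Solver

/-as-* : ∀ z m .{{_ : ℕ.NonZero m}} → z / m ≡ ι z * (+ 1 / m)
/-as-* z m = *-cancelˡ (ιₙ m) {{ιₙ-nonZero m}} (begin
  ιₙ m * (z / m)             ≡⟨ ιₙ-*-/ z m ⟩
  ι z                        ≡⟨ sym (ℚ.*-identityʳ (ι z)) ⟩
  ι z * 1ℚ                   ≡⟨ cong (ι z *_) (sym (ιₙ-*-/ (+ 1) m)) ⟩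
  ι z * (ιₙ m * (+ 1 / m))   ≡⟨ x*[y*z]≡y*[x*z] (ι z) (ιₙ m) (+ 1 / m) ⟩
  ιₙ m * (ι z * (+ 1 / m))   ∎)

inv!-step : ∀ n → ιₙ (suc n) * inv! (suc n) ≡ inv! n
inv!-step n = *-cancelˡ (ιₙ (n !)) {{ιₙ-nonZero (n !) {{n !≢0}}}} (begin
  ιₙ (n !) * (ιₙ (suc n) * inv! (suc n))
    ≡⟨ x*[y*z]≡y*[x*z] (ιₙ (n !)) (ιₙ (suc n)) (inv! (suc n)) ⟩
  ιₙ (suc n) * (ιₙ (n !) * inv! (suc n))
    ≡⟨ sym (ℚ.*-assoc (ιₙ (suc n)) (ιₙ (n !)) (inv! (suc n))) ⟩
  ιₙ (suc n) * ιₙ (n !) * inv! (suc n)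
    ≡⟨ cong (_* inv! (suc n)) (sym (ιₙ-homo-* (suc n) (n !))) ⟩
  ιₙ (suc n !) * inv! (suc n)
    ≡⟨ ιₙ-*-/ (+ 1) (suc n !) {{suc n !≢0}} ⟩
  1ℚ
    ≡⟨ sym (ιₙ-*-/ (+ 1) (n !) {{n !≢0}}) ⟩
  ιₙ (n !) * inv! n
    ∎)

sum-cong : ∀ n {f g : ℕ → ℚ} → (∀ i → i ≤ n → f i ≡ g i) → sumℚ n f ≡ sumℚ n g
sum-cong zero    f≡g = f≡g 0 z≤n
sum-cong (suc n) f≡g =
  cong₂ _+_ (sum-cong n (λ i i≤n → f≡g i (ℕ.m≤n⇒m≤1+n i≤n))) (f≡g (suc n) ℕ.≤-refl)

sum-+ : ∀ n f g → sumℚ n (λ i → f i + g i) ≡ sumℚ n f + sumℚ n g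
sum-+ zero    f g = refl
sum-+ (suc n) f g = trans (cong (_+ (f (suc n) + g (suc n))) (sum-+ n f g))
  (+-interchange (sumℚ n f) (sumℚ n g) (f (suc n)) (g (suc n)))

*-distribˡ-sum : ∀ n c f → c * sumℚ n f ≡ sumℚ n (λ i → c * f i)
*-distribˡ-sum zero    c f = refl
*-distribˡ-sum (suc n) c f =
  trans (ℚ.*-distribˡ-+ c (sumℚ n f) (f (suc n))) (cong (_+ c * f (suc n)) (*-distribˡ-sum n c f))

*-distribʳ-sum : ∀ n c f → sumℚ n f * c ≡ sumℚ n (λ i → f i * c)
*-distribʳ-sum n c f = trans (ℚ.*-comm (sumℚ n f) c)
  (trans (*-distribˡ-sum n c f) (sum-cong n (λ i _ → ℚ.*-comm c (f i))))

neg-distrib-sum : ∀ n f → - sumℚ n f ≡ sumℚ n (λ i → - f i)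
neg-distrib-sum zero    f = refl
neg-distrib-sum (suc n) f =
  trans (ℚ.neg-distrib-+ (sumℚ n f) (f (suc n))) (cong (_+ - f (suc n)) (neg-distrib-sum n f))

sum-- : ∀ n f g → sumℚ n (λ i → f i - g i) ≡ sumℚ n f - sumℚ n g
sum-- n f g = trans (sum-+ n f (λ i → - g i)) (cong (_+_ (sumℚ n f)) (sym (neg-distrib-sum n g)))

sum-zero : ∀ n {f} → (∀ i → i ≤ n → f i ≡ 0ℚ) → sumℚ n f ≡ 0ℚ
sum-zero n f≡0 = trans (sum-cong n f≡0) (sum-0ℚ n)
  where
  sum-0ℚ : ∀ n → sumℚ n (λ _ → 0ℚ) ≡ 0ℚ
  sum-0ℚ zero    = refl
  sum-0ℚ (suc n) = cong (_+ 0ℚ) (sum-0ℚ n)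

sum-suc : ∀ n f → sumℚ (suc n) f ≡ f 0 + sumℚ n (λ i → f (suc i))
sum-suc zero    f = refl
sum-suc (suc n) f = trans (cong (_+ f (suc (suc n))) (sum-suc n f))
  (ℚ.+-assoc (f 0) (sumℚ n (λ i → f (suc i))) (f (suc (suc n))))

sum-extend : ∀ {m n} f → m ≤ n → (∀ i → m < i → f i ≡ 0ℚ) → sumℚ n f ≡ sumℚ m f
sum-extend {m} f m≤n vanish = go (ℕ.≤⇒≤′ m≤n)
  where
  go : ∀ {n} → m ℕ.≤′ n → sumℚ n f ≡ sumℚ m f
  go ℕ.≤′-refl            = refl
  go (ℕ.≤′-step {n} m≤′n) =
    trans (cong₂ _+_ (go m≤′n) (vanish (suc n) (s≤s (ℕ.≤′⇒≤ m≤′n)))) (ℚ.+-identityʳ (sumℚ m f))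

sum-comm : ∀ m n (f : ℕ → ℕ → ℚ) →
           sumℚ m (λ i → sumℚ n (f i)) ≡ sumℚ n (λ j → sumℚ m (λ i → f i j))
sum-comm zero    n f = refl
sum-comm (suc m) n f = trans (cong (_+ sumℚ n (f (suc m))) (sum-comm m n f))
  (sym (sum-+ n (λ j → sumℚ m (λ i → f i j)) (f (suc m))))

sum-reverse : ∀ n f → sumℚ n f ≡ sumℚ n (λ i → f (n ∸ i))
sum-reverse zero    f = refl
sum-reverse (suc n) f = begin
  sumℚ (suc n) f
    ≡⟨ sum-suc n f ⟩
  f 0 + sumℚ n (λ i → f (suc i))
    ≡⟨ cong (_+_ (f 0)) (sum-reverse n (λ i → f (suc i))) ⟩
  f 0 + sumℚ n (λ i → f (suc (n ∸ i)))
    ≡⟨ ℚ.+-comm (f 0) _ ⟩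
  sumℚ n (λ i → f (suc (n ∸ i))) + f 0
    ≡⟨ cong₂ _+_ (sum-cong n (λ i i≤n → cong f (sym (ℕ.+-∸-assoc 1 i≤n))))
                 (cong f (sym (ℕ.n∸n≡0 n))) ⟩
  sumℚ (suc n) (λ i → f (suc n ∸ i))
    ∎

sum-triangle : ∀ n (φ : ℕ → ℕ → ℚ) →
  sumℚ n (λ s → sumℚ s (φ s)) ≡ sumℚ n (λ i → sumℚ (n ∸ i) (λ t → φ (i ℕ.+ t) i))
sum-triangle zero    φ = refl
sum-triangle (suc n) φ = begin
  sumℚ (suc n) (λ s → sumℚ s (φ s))
    ≡⟨ sum-suc n _ ⟩
  φ 0 0 + sumℚ n (λ s → sumℚ (suc s) (φ (suc s)))
    ≡⟨ cong (_+_ (φ 0 0)) (trans (sum-cong n (λ s _ → sum-suc s (φ (suc s)))) (sum-+ n _ _)) ⟩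
  φ 0 0 + (sumℚ n (λ s → φ (suc s) 0) + sumℚ n (λ s → sumℚ s (λ i → φ (suc s) (suc i))))
    ≡⟨ sym (ℚ.+-assoc (φ 0 0) _ _) ⟩
  (φ 0 0 + sumℚ n (λ s → φ (suc s) 0)) + sumℚ n (λ s → sumℚ s (λ i → φ (suc s) (suc i)))
    ≡⟨ cong₂ _+_ (sym (sum-suc n (λ t → φ t 0))) (sum-triangle n (λ s i → φ (suc s) (suc i))) ⟩
  sumℚ (suc n) (λ t → φ t 0) + sumℚ n (λ i → sumℚ (n ∸ i) (λ t → φ (suc (i ℕ.+ t)) (suc i)))
    ≡⟨ sym (sum-suc n _) ⟩
  sumℚ (suc n) (λ i → sumℚ (suc n ∸ i) (λ t → φ (i ℕ.+ t) i))
    ∎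

∂ : Series → Series
∂ f n = ιₙ (suc n) * f (suc n)

⊛-congˡ : ∀ {f f′} g n → (∀ i → i ≤ n → f i ≡ f′ i) → (f ⊛ g) n ≡ (f′ ⊛ g) n
⊛-congˡ g n f≡f′ = sum-cong n (λ i i≤n → cong (_* g (n ∸ i)) (f≡f′ i i≤n))

⊛-congʳ : ∀ f {g g′} n → (∀ i → i ≤ n → g i ≡ g′ i) → (f ⊛ g) n ≡ (f ⊛ g′) n
⊛-congʳ f n g≡g′ = sum-cong n (λ i _ → cong (f i *_) (g≡g′ (n ∸ i) (ℕ.m∸n≤m n i)))

⊛-comm : ∀ f g n → (f ⊛ g) n ≡ (g ⊛ f) n
⊛-comm f g n = trans (sum-reverse n _) (sum-cong n (λ i i≤n →
  trans (cong (λ j → f (n ∸ i) * g j) (ℕ.m∸[m∸n]≡n i≤n)) (ℚ.*-comm (f (n ∸ i)) (g i))))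

⊛-assoc : ∀ f g h n → ((f ⊛ g) ⊛ h) n ≡ (f ⊛ (g ⊛ h)) n
⊛-assoc f g h n = begin
  sumℚ n (λ s → sumℚ s (λ i → f i * g (s ∸ i)) * h (n ∸ s))
    ≡⟨ sum-cong n (λ s _ → *-distribʳ-sum s (h (n ∸ s)) _) ⟩
  sumℚ n (λ s → sumℚ s (λ i → f i * g (s ∸ i) * h (n ∸ s)))
    ≡⟨ sum-triangle n (λ s i → f i * g (s ∸ i) * h (n ∸ s)) ⟩
  sumℚ n (λ i → sumℚ (n ∸ i) (λ t → f i * g (i ℕ.+ t ∸ i) * h (n ∸ (i ℕ.+ t))))
    ≡⟨ sum-cong n (λ i _ → trans (sum-cong (n ∸ i) (λ t _ → reindex i t))
                                 (sym (*-distribˡ-sum (n ∸ i) (f i) _))) ⟩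
  sumℚ n (λ i → f i * sumℚ (n ∸ i) (λ t → g t * h (n ∸ i ∸ t)))
    ∎
  where
  reindex : ∀ i t → f i * g (i ℕ.+ t ∸ i) * h (n ∸ (i ℕ.+ t)) ≡ f i * (g t * h (n ∸ i ∸ t))
  reindex i t = trans (cong₂ (λ j k → f i * g j * h k) (ℕ.m+n∸m≡n i t) (sym (ℕ.∸-+-assoc n i t)))
                      (ℚ.*-assoc (f i) (g t) (h (n ∸ i ∸ t)))

⊛-lcomm : ∀ f g h n → (f ⊛ (g ⊛ h)) n ≡ (g ⊛ (f ⊛ h)) n
⊛-lcomm f g h n = begin
  (f ⊛ (g ⊛ h)) n   ≡⟨ sym (⊛-assoc f g h n) ⟩
  ((f ⊛ g) ⊛ h) n   ≡⟨ ⊛-congˡ h n (λ i _ → ⊛-comm f g i) ⟩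
  ((g ⊛ f) ⊛ h) n   ≡⟨ ⊛-assoc g f h n ⟩
  (g ⊛ (f ⊛ h)) n   ∎

⊛-distribˡ-⊕ : ∀ f g h n → (f ⊛ (g ⊕ h)) n ≡ (f ⊛ g) n + (f ⊛ h) n
⊛-distribˡ-⊕ f g h n =
  trans (sum-cong n (λ i _ → ℚ.*-distribˡ-+ (f i) (g (n ∸ i)) (h (n ∸ i)))) (sum-+ n _ _)

⊛-distribʳ-⊖ : ∀ f g h n → ((f ⊖ g) ⊛ h) n ≡ (f ⊛ h) n - (g ⊛ h) n
⊛-distribʳ-⊖ f g h n = trans (sum-cong n (λ i _ → *-distribʳ-- (f i) (g i) (h (n ∸ i)))) (sum-- n _ _)
  where
  *-distribʳ-- : ∀ x y z → (x - y) * z ≡ x * z - y * z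
  *-distribʳ-- x y z = trans (ℚ.*-distribʳ-+ z x (- y)) (cong (_+_ (x * z)) (sym (ℚ.neg-distribˡ-* y z)))

·-⊛ : ∀ c f g n → ((c · f) ⊛ g) n ≡ c * (f ⊛ g) n
·-⊛ c f g n = trans (sum-cong n (λ i _ → ℚ.*-assoc c (f i) (g (n ∸ i)))) (sym (*-distribˡ-sum n c _))

⊛-· : ∀ c f g n → (f ⊛ (c · g)) n ≡ c * (f ⊛ g) n
⊛-· c f g n =
  trans (sum-cong n (λ i _ → x*[y*z]≡y*[x*z] (f i) c (g (n ∸ i)))) (sym (*-distribˡ-sum n c _))

⊛-identityˡ : ∀ f n → (const 1ℚ ⊛ f) n ≡ f n
⊛-identityˡ f zero    = ℚ.*-identityˡ (f 0)
⊛-identityˡ f (suc n) = begin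
  (const 1ℚ ⊛ f) (suc n)
    ≡⟨ sum-suc n _ ⟩
  1ℚ * f (suc n) + sumℚ n (λ i → 0ℚ * f (n ∸ i))
    ≡⟨ cong₂ _+_ (ℚ.*-identityˡ (f (suc n))) (sum-zero n (λ i _ → ℚ.*-zeroˡ (f (n ∸ i)))) ⟩
  f (suc n) + 0ℚ
    ≡⟨ ℚ.+-identityʳ (f (suc n)) ⟩
  f (suc n)
    ∎

⊛-zeroʳ : ∀ f n → (f ⊛ (λ _ → 0ℚ)) n ≡ 0ℚ
⊛-zeroʳ f n = sum-zero n (λ i _ → ℚ.*-zeroʳ (f i))

sum-⊛ : ∀ f (g : ℕ → Series) m n →
        sumℚ m (λ k → (f ⊛ g k) n) ≡ (f ⊛ (λ j → sumℚ m (λ k → g k j))) n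
sum-⊛ f g m n = begin
  sumℚ m (λ k → sumℚ n (λ i → f i * g k (n ∸ i)))
    ≡⟨ sum-comm m n _ ⟩
  sumℚ n (λ i → sumℚ m (λ k → f i * g k (n ∸ i)))
    ≡⟨ sum-cong n (λ i _ → sym (*-distribˡ-sum m (f i) _)) ⟩
  sumℚ n (λ i → f i * sumℚ m (λ k → g k (n ∸ i)))
    ∎

∂-leibniz : ∀ f g n → ∂ (f ⊛ g) n ≡ (∂ f ⊛ g) n + (f ⊛ ∂ g) n
∂-leibniz f g n = begin
  ιₙ (suc n) * sumℚ (suc n) T
    ≡⟨ *-distribˡ-sum (suc n) (ιₙ (suc n)) T ⟩
  sumℚ (suc n) (λ i → ιₙ (suc n) * T i)
    ≡⟨ sum-cong (suc n) (λ i i≤ → trans (cong (_* T i) (split i≤))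
                                        (ℚ.*-distribʳ-+ (T i) (ιₙ i) (ιₙ (suc n ∸ i)))) ⟩
  sumℚ (suc n) (λ i → ιₙ i * T i + ιₙ (suc n ∸ i) * T i)
    ≡⟨ sum-+ (suc n) _ _ ⟩
  sumℚ (suc n) (λ i → ιₙ i * T i) + sumℚ (suc n) (λ i → ιₙ (suc n ∸ i) * T i)
    ≡⟨ cong₂ _+_ differentiate-f differentiate-g ⟩
  (∂ f ⊛ g) n + (f ⊛ ∂ g) n
    ∎
  where
  T : ℕ → ℚ
  T i = f i * g (suc n ∸ i)
  split : ∀ {i} → i ≤ suc n → ιₙ (suc n) ≡ ιₙ i + ιₙ (suc n ∸ i)
  split {i} i≤ = trans (cong ιₙ (sym (ℕ.m+[n∸m]≡n i≤))) (ιₙ-homo-+ i (suc n ∸ i))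
  differentiate-f : sumℚ (suc n) (λ i → ιₙ i * T i) ≡ (∂ f ⊛ g) n
  differentiate-f = begin
    sumℚ (suc n) (λ i → ιₙ i * T i)
      ≡⟨ sum-suc n _ ⟩
    0ℚ * T 0 + sumℚ n (λ i → ιₙ (suc i) * T (suc i))
      ≡⟨ cong (_+ sumℚ n (λ i → ιₙ (suc i) * T (suc i))) (ℚ.*-zeroˡ (T 0)) ⟩
    0ℚ + sumℚ n (λ i → ιₙ (suc i) * T (suc i))
      ≡⟨ ℚ.+-identityˡ _ ⟩
    sumℚ n (λ i → ιₙ (suc i) * T (suc i))
      ≡⟨ sum-cong n (λ i _ → sym (ℚ.*-assoc (ιₙ (suc i)) (f (suc i)) _)) ⟩
    (∂ f ⊛ g) n
      ∎
  differentiate-g : sumℚ (suc n) (λ i → ιₙ (suc n ∸ i) * T i) ≡ (f ⊛ ∂ g) n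
  differentiate-g = begin
    sumℚ n (λ i → ιₙ (suc n ∸ i) * T i) + ιₙ (suc n ∸ suc n) * T (suc n)
      ≡⟨ cong₂ _+_ (sum-cong n (λ i i≤n → trans (cong (λ j → ιₙ j * (f i * g j)) (ℕ.+-∸-assoc 1 i≤n))
                                                (x*[y*z]≡y*[x*z] (ιₙ (suc (n ∸ i))) (f i) _)))
                   (trans (cong (λ j → ιₙ j * T (suc n)) (ℕ.n∸n≡0 n)) (ℚ.*-zeroˡ (T (suc n)))) ⟩
    (f ⊛ ∂ g) n + 0ℚ
      ≡⟨ ℚ.+-identityʳ _ ⟩
    (f ⊛ ∂ g) n
      ∎

∂-⊖ : ∀ f g n → ∂ (f ⊖ g) n ≡ ∂ f n - ∂ g n
∂-⊖ f g n = solve 3 (λ k x y → k :* (x :- y) := k :* x :- k :* y) refl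
                    (ιₙ (suc n)) (f (suc n)) (g (suc n))
  where open ℚ-Solver.+-*-Solver

∂-· : ∀ c f n → ∂ (c · f) n ≡ c * ∂ f n
∂-· c f n = x*[y*z]≡y*[x*z] (ιₙ (suc n)) c (f (suc n))

∂-const : ∀ c n → ∂ (const c) n ≡ 0ℚ
∂-const c n = ℚ.*-zeroʳ (ιₙ (suc n))

∂-X : ∀ n → ∂ X n ≡ const 1ℚ n
∂-X zero    = refl
∂-X (suc n) = ℚ.*-zeroʳ (ιₙ (suc (suc n)))

Causal : (Series → Series) → Set
Causal Φ = ∀ {f g} n → (∀ i → i ≤ n → f i ≡ g i) → Φ f n ≡ Φ g n

∂-unique : ∀ Φ → Causal Φ → ∀ {f g} → (∀ n → ∂ f n ≡ Φ f n) → (∀ n → ∂ g n ≡ Φ g n) →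
           f 0 ≡ g 0 → ∀ n → f n ≡ g n
∂-unique Φ causal {f} {g} ∂f ∂g f0≡g0 = <-rec (λ n → f n ≡ g n) step
  where
  step : ∀ n → (∀ {i} → i < n → f i ≡ g i) → f n ≡ g n
  step zero    _   = f0≡g0
  step (suc n) f≡g = *-cancelˡ (ιₙ (suc n)) (begin
    ∂ f n  ≡⟨ ∂f n ⟩
    Φ f n  ≡⟨ causal n (λ i i≤n → f≡g (s≤s i≤n)) ⟩
    Φ g n  ≡⟨ sym (∂g n) ⟩
    ∂ g n  ∎)

pow-vanish : ∀ {g} → g 0 ≡ 0ℚ → ∀ m j → j < m → pow g m j ≡ 0ℚ
pow-vanish {g} g0≡0 (suc m) j j<1+m = sum-zero j (term j j<1+m)
  where
  term : ∀ j → j < suc m → ∀ i → i ≤ j → g i * pow g m (j ∸ i) ≡ 0ℚ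
  term j       _         zero    _ = trans (cong (_* pow g m j) g0≡0) (ℚ.*-zeroˡ (pow g m j))
  term (suc j) (s≤s j<m) (suc i) _ =
    trans (cong (g (suc i) *_) (pow-vanish g0≡0 m (j ∸ i) (ℕ.≤-<-trans (ℕ.m∸n≤m j i) j<m)))
          (ℚ.*-zeroʳ (g (suc i)))

∂-pow : ∀ g m n → ∂ (pow g (suc m)) n ≡ ιₙ (suc m) * (∂ g ⊛ pow g m) n
∂-pow g zero n = begin
  ∂ (g ⊛ pow g 0) n
    ≡⟨ ∂-leibniz g (pow g 0) n ⟩
  (∂ g ⊛ pow g 0) n + (g ⊛ ∂ (pow g 0)) n
    ≡⟨ cong (_+_ ((∂ g ⊛ pow g 0) n))
            (trans (⊛-congʳ g n (λ i _ → ∂-const 1ℚ i)) (⊛-zeroʳ g n)) ⟩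
  (∂ g ⊛ pow g 0) n + 0ℚ
    ≡⟨ ℚ.+-identityʳ _ ⟩
  (∂ g ⊛ pow g 0) n
    ≡⟨ sym (ℚ.*-identityˡ _) ⟩
  1ℚ * (∂ g ⊛ pow g 0) n
    ∎
∂-pow g (suc m) n = begin
  ∂ (g ⊛ pow g (suc m)) n
    ≡⟨ ∂-leibniz g (pow g (suc m)) n ⟩
  y + (g ⊛ ∂ (pow g (suc m))) n
    ≡⟨ cong (_+_ y) (⊛-congʳ g n (λ i _ → ∂-pow g m i)) ⟩
  y + (g ⊛ (ιₙ (suc m) · (∂ g ⊛ pow g m))) n
    ≡⟨ cong (_+_ y) (⊛-· (ιₙ (suc m)) g (∂ g ⊛ pow g m) n) ⟩
  y + ιₙ (suc m) * (g ⊛ (∂ g ⊛ pow g m)) n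
    ≡⟨ cong (λ x → y + ιₙ (suc m) * x) (⊛-lcomm g (∂ g) (pow g m) n) ⟩
  y + ιₙ (suc m) * y
    ≡⟨ solve 2 (λ y k → y :+ k :* y := (con 1ℚ :+ k) :* y) refl y (ιₙ (suc m)) ⟩
  (1ℚ + ιₙ (suc m)) * y
    ≡⟨ cong (_* y) (sym (ιₙ-suc (suc m))) ⟩
  ιₙ (suc (suc m)) * y
    ∎
  where
  open ℚ-Solver.+-*-Solver
  y : ℚ
  y = (∂ g ⊛ pow g (suc m)) n

expS-extend : ∀ {g} → g 0 ≡ 0ℚ → ∀ {j n} → j ≤ n →
              expS g j ≡ sumℚ n (λ m → inv! m * pow g m j)
expS-extend {g} g0≡0 {j} j≤n = sym (sum-extend _ j≤n (λ m j<m →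
  trans (cong (inv! m *_) (pow-vanish g0≡0 m j j<m)) (ℚ.*-zeroʳ (inv! m))))

∂-expS : ∀ {g} → g 0 ≡ 0ℚ → ∀ n → ∂ (expS g) n ≡ (∂ g ⊛ expS g) n
∂-expS {g} g0≡0 n = begin
  ιₙ (suc n) * sumℚ (suc n) (λ m → inv! m * pow g m (suc n))
    ≡⟨ *-distribˡ-sum (suc n) (ιₙ (suc n)) _ ⟩
  sumℚ (suc n) (λ m → ιₙ (suc n) * (inv! m * pow g m (suc n)))
    ≡⟨ sum-cong (suc n) (λ m _ → x*[y*z]≡y*[x*z] (ιₙ (suc n)) (inv! m) _) ⟩
  sumℚ (suc n) (λ m → inv! m * ∂ (pow g m) n)
    ≡⟨ sum-suc n _ ⟩
  inv! 0 * ∂ (pow g 0) n + sumℚ n (λ m → inv! (suc m) * ∂ (pow g (suc m)) n)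
    ≡⟨ cong₂ _+_ (trans (cong (inv! 0 *_) (∂-const 1ℚ n)) (ℚ.*-zeroʳ (inv! 0)))
                 (sum-cong n (λ m _ → term m)) ⟩
  0ℚ + sumℚ n (λ m → (∂ g ⊛ (inv! m · pow g m)) n)
    ≡⟨ ℚ.+-identityˡ _ ⟩
  sumℚ n (λ m → (∂ g ⊛ (inv! m · pow g m)) n)
    ≡⟨ sum-⊛ (∂ g) (λ m → inv! m · pow g m) n n ⟩
  (∂ g ⊛ (λ j → sumℚ n (λ m → inv! m * pow g m j))) n
    ≡⟨ ⊛-congʳ (∂ g) n (λ j j≤n → sym (expS-extend {g} g0≡0 j≤n)) ⟩
  (∂ g ⊛ expS g) n
    ∎
  where
  term : ∀ m → inv! (suc m) * ∂ (pow g (suc m)) n ≡ (∂ g ⊛ (inv! m · pow g m)) n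
  term m = begin
    inv! (suc m) * ∂ (pow g (suc m)) n
      ≡⟨ cong (inv! (suc m) *_) (∂-pow g m n) ⟩
    inv! (suc m) * (ιₙ (suc m) * (∂ g ⊛ pow g m) n)
      ≡⟨ sym (ℚ.*-assoc (inv! (suc m)) (ιₙ (suc m)) _) ⟩
    inv! (suc m) * ιₙ (suc m) * (∂ g ⊛ pow g m) n
      ≡⟨ cong (_* (∂ g ⊛ pow g m) n) (trans (ℚ.*-comm (inv! (suc m)) (ιₙ (suc m))) (inv!-step m)) ⟩
    inv! m * (∂ g ⊛ pow g m) n
      ≡⟨ sym (⊛-· (inv! m) (∂ g) (pow g m) n) ⟩
    (∂ g ⊛ (inv! m · pow g m)) n
      ∎


egf : (ℕ → ℤ) → Series
egf a n = ι (a n) * inv! n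

∂-egf : ∀ a n → ∂ (egf a) n ≡ egf (a ∘ suc) n
∂-egf a n = trans (x*[y*z]≡y*[x*z] (ιₙ (suc n)) (ι (a (suc n))) (inv! (suc n)))
                  (cong (ι (a (suc n)) *_) (inv!-step n))

expLin≡egf : ∀ c n → expLin c n ≡ egf (c ℤ.^_) n
expLin≡egf c n = /-as-* (c ℤ.^ n) (n !) {{n !≢0}}

∂-expLin : ∀ c n → ∂ (expLin c) n ≡ ι c * expLin c n
∂-expLin c n = begin
  ∂ (expLin c) n               ≡⟨ cong (ιₙ (suc n) *_) (expLin≡egf c (suc n)) ⟩
  ∂ (egf (c ℤ.^_)) n           ≡⟨ ∂-egf (c ℤ.^_) n ⟩
  ι (c ℤ.* c ℤ.^ n) * inv! n   ≡⟨ cong (_* inv! n) (ι-homo-* c (c ℤ.^ n)) ⟩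
  ι c * ι (c ℤ.^ n) * inv! n   ≡⟨ ℚ.*-assoc (ι c) (ι (c ℤ.^ n)) (inv! n) ⟩
  ι c * egf (c ℤ.^_) n         ≡⟨ cong (ι c *_) (sym (expLin≡egf c n)) ⟩
  ι c * expLin c n             ∎

module Triangle (d r : ℤ) where

  h : ℕ → ℕ → ℤ
  h = h₀ d r

  weight : ℕ → ℚ
  weight k = ι d * ιₙ k - ι r

  ι-weight : ∀ k → ι (d ℤ.* + k ℤ.- r) ≡ weight k
  ι-weight k = trans (ι-homo-- (d ℤ.* + k) r) (cong (_- ι r) (ι-homo-* d (+ k)))

  ι-h-suc-zero : ∀ n → ι (h (suc n) 0) ≡ weight 0 * ι (h n 0)
  ι-h-suc-zero n = trans (ι-homo-* (d ℤ.* + 0 ℤ.- r) (h n 0)) (cong (_* ι (h n 0)) (ι-weight 0))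

  ι-h-suc-suc : ∀ n k → ι (h (suc n) (suc k)) ≡ weight (suc k) * ι (h n (suc k)) + ι (h n k)
  ι-h-suc-suc n k = trans (ι-homo-+ (w ℤ.* h n (suc k)) (h n k)) (cong (_+ ι (h n k))
    (trans (ι-homo-* w (h n (suc k))) (cong (_* ι (h n (suc k))) (ι-weight (suc k)))))
    where
    w : ℤ
    w = d ℤ.* + suc k ℤ.- r

  h-vanish : ∀ {n k} → n < k → h n k ≡ 0ℤ
  h-vanish {zero}  {suc k} _         = refl
  h-vanish {suc n} {suc k} (s≤s n<k) = begin
    w ℤ.* h n (suc k) ℤ.+ h n k
      ≡⟨ cong₂ (λ x y → w ℤ.* x ℤ.+ y) (h-vanish (ℕ.m<n⇒m<1+n n<k)) (h-vanish n<k) ⟩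
    w ℤ.* 0ℤ ℤ.+ 0ℤ
      ≡⟨ cong (ℤ._+ 0ℤ) (ℤ.*-zeroʳ w) ⟩
    0ℤ
      ∎
    where
    w : ℤ
    w = d ℤ.* + suc k ℤ.- r

  col : ℕ → Series
  col k = egf (λ n → h n k)

  col-vanish : ∀ {n k} → n < k → col k n ≡ 0ℚ
  col-vanish {n} n<k = trans (cong (λ z → ι z * inv! n) (h-vanish n<k)) (ℚ.*-zeroˡ (inv! n))

  -- U_{k−1}, using the paper's convention h(n, −1) = 0.
  col⁻ : ℕ → Series
  col⁻ zero    _ = 0ℚ
  col⁻ (suc k)   = col k

  ∂-col : ∀ k n → ∂ (col k) n ≡ weight k * col k n + col⁻ k n
  ∂-col zero n = begin
    ∂ (col 0) n                    ≡⟨ ∂-egf (λ n → h n 0) n ⟩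
    ι (h (suc n) 0) * inv! n       ≡⟨ cong (_* inv! n) (ι-h-suc-zero n) ⟩
    weight 0 * ι (h n 0) * inv! n  ≡⟨ ℚ.*-assoc (weight 0) (ι (h n 0)) (inv! n) ⟩
    weight 0 * col 0 n             ≡⟨ sym (ℚ.+-identityʳ _) ⟩
    weight 0 * col 0 n + 0ℚ        ∎
  ∂-col (suc k) n = begin
    ∂ (col (suc k)) n
      ≡⟨ ∂-egf (λ n → h n (suc k)) n ⟩
    ι (h (suc n) (suc k)) * inv! n
      ≡⟨ cong (_* inv! n) (ι-h-suc-suc n k) ⟩
    (weight (suc k) * ι (h n (suc k)) + ι (h n k)) * inv! n
      ≡⟨ solve 4 (λ w x y i → (w :* x :+ y) :* i := w :* (x :* i) :+ y :* i) refl
           (weight (suc k)) (ι (h n (suc k))) (ι (h n k)) (inv! n) ⟩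
    weight (suc k) * col (suc k) n + col k n
      ∎
    where open ℚ-Solver.+-*-Solver

  e : Series
  e = expLin d

  a : Series
  a = e ⊖ const 1ℚ

  ∂-a : ∀ n → ∂ a n ≡ (ι d · e) n
  ∂-a n = begin
    ∂ a n                    ≡⟨ ∂-⊖ e (const 1ℚ) n ⟩
    ∂ e n - ∂ (const 1ℚ) n   ≡⟨ cong₂ _-_ (∂-expLin d n) (∂-const 1ℚ n) ⟩
    ι d * e n - 0ℚ           ≡⟨ ℚ.+-identityʳ (ι d * e n) ⟩
    ι d * e n                ∎

  e⊛≡a⊛+id : ∀ f n → (e ⊛ f) n ≡ (a ⊛ f) n + f n
  e⊛≡a⊛+id f n = begin
    (e ⊛ f) n
      ≡⟨ solve 2 (λ x y → x := (x :- y) :+ y) refl ((e ⊛ f) n) (f n) ⟩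
    ((e ⊛ f) n - f n) + f n
      ≡⟨ cong (λ x → ((e ⊛ f) n - x) + f n) (sym (⊛-identityˡ f n)) ⟩
    ((e ⊛ f) n - (const 1ℚ ⊛ f) n) + f n
      ≡⟨ cong (_+ f n) (sym (⊛-distribʳ-⊖ e (const 1ℚ) f n)) ⟩
    (a ⊛ f) n + f n
      ∎
    where open ℚ-Solver.+-*-Solver

  a⊛col⁻ : ∀ k n → (a ⊛ col⁻ k) n ≡ ι d * ιₙ k * col k n
  a⊛col⁻ zero n = trans (⊛-zeroʳ a n)
    (sym (trans (cong (_* col 0 n) (ℚ.*-zeroʳ (ι d))) (ℚ.*-zeroˡ (col 0 n))))
  a⊛col⁻ (suc k) = ∂-unique Φ causal ∂-lhs ∂-rhs (trans (ℚ.*-zeroˡ (col k 0)) (sym (ℚ.*-zeroʳ c)))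
    where
    open ℚ-Solver.+-*-Solver
    c : ℚ
    c = ι d * ιₙ (suc k)
    Φ : Series → Series
    Φ f n = weight (suc k) * f n + c * col k n
    causal : Causal Φ
    causal n f≡g = cong (λ x → weight (suc k) * x + c * col k n) (f≡g n ℕ.≤-refl)
    ∂-lhs : ∀ n → ∂ (a ⊛ col k) n ≡ Φ (a ⊛ col k) n
    ∂-lhs n = begin
      ∂ (a ⊛ col k) n
        ≡⟨ ∂-leibniz a (col k) n ⟩
      (∂ a ⊛ col k) n + (a ⊛ ∂ (col k)) n
        ≡⟨ cong₂ _+_ (trans (⊛-congˡ (col k) n (λ i _ → ∂-a i)) (·-⊛ (ι d) e (col k) n))
                     (trans (⊛-congʳ a n (λ i _ → ∂-col k i))
                            (⊛-distribˡ-⊕ a (weight k · col k) (col⁻ k) n)) ⟩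
      ι d * (e ⊛ col k) n + ((a ⊛ (weight k · col k)) n + (a ⊛ col⁻ k) n)
        ≡⟨ cong₂ (λ x y → ι d * x + y) (e⊛≡a⊛+id (col k) n)
                 (cong₂ _+_ (⊛-· (weight k) a (col k) n) (a⊛col⁻ k n)) ⟩
      ι d * (x + u) + (weight k * x + ι d * ιₙ k * u)
        ≡⟨ solve 5 (λ D R K x u → D :* (x :+ u) :+ ((D :* K :- R) :* x :+ D :* K :* u)
                                 := (D :* (con 1ℚ :+ K) :- R) :* x :+ D :* (con 1ℚ :+ K) :* u)
             refl (ι d) (ι r) (ιₙ k) x u ⟩
      (ι d * (1ℚ + ιₙ k) - ι r) * x + ι d * (1ℚ + ιₙ k) * u
        ≡⟨ cong (λ K → (ι d * K - ι r) * x + ι d * K * u) (sym (ιₙ-suc k)) ⟩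
      Φ (a ⊛ col k) n
        ∎
      where
      x u : ℚ
      x = (a ⊛ col k) n
      u = col k n
    ∂-rhs : ∀ n → ∂ (c · col (suc k)) n ≡ Φ (c · col (suc k)) n
    ∂-rhs n = begin
      ∂ (c · col (suc k)) n
        ≡⟨ ∂-· c (col (suc k)) n ⟩
      c * ∂ (col (suc k)) n
        ≡⟨ cong (c *_) (∂-col (suc k) n) ⟩
      c * (weight (suc k) * col (suc k) n + col k n)
        ≡⟨ solve 4 (λ c w y z → c :* (w :* y :+ z) := w :* (c :* y) :+ c :* z)
                   refl c (weight (suc k)) (col (suc k) n) (col k n) ⟩
      Φ (c · col (suc k)) n
        ∎

  ∂-col≡e⊛col⁻ : ∀ k n → ∂ (col k) n ≡ (e ⊛ col⁻ k) n - ι r * col k n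
  ∂-col≡e⊛col⁻ k n = begin
    ∂ (col k) n
      ≡⟨ ∂-col k n ⟩
    weight k * u + v
      ≡⟨ solve 5 (λ D K R u v → (D :* K :- R) :* u :+ v := (D :* K :* u :+ v) :- R :* u)
                 refl (ι d) (ιₙ k) (ι r) u v ⟩
    (ι d * ιₙ k * u + v) - ι r * u
      ≡⟨ cong (λ x → (x + v) - ι r * u) (sym (a⊛col⁻ k n)) ⟩
    ((a ⊛ col⁻ k) n + v) - ι r * u
      ≡⟨ cong (_- ι r * u) (sym (e⊛≡a⊛+id (col⁻ k) n)) ⟩
    (e ⊛ col⁻ k) n - ι r * u
      ∎
    where
    open ℚ-Solver.+-*-Solver
    u v : ℚ
    u = col k n
    v = col⁻ k n

  egf-b≡sum-col : ∀ {n m} → n ≤ m → egf-b d r n ≡ sumℚ m (λ k → col k n)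
  egf-b≡sum-col {n} {m} n≤m = begin
    egf-b d r n                         ≡⟨ /-as-* (b d r n) (n !) {{n !≢0}} ⟩
    ι (sumℤ n (h n)) * inv! n           ≡⟨ cong (_* inv! n) (ι-sumℤ n (h n)) ⟩
    sumℚ n (λ k → ι (h n k)) * inv! n   ≡⟨ *-distribʳ-sum n (inv! n) _ ⟩
    sumℚ n (λ k → col k n)              ≡⟨ sym (sum-extend (λ k → col k n) n≤m (λ k → col-vanish)) ⟩
    sumℚ m (λ k → col k n)              ∎

  ∂-egf-b : ∀ n → ∂ (egf-b d r) n ≡ ((e ⊖ (ι r · const 1ℚ)) ⊛ egf-b d r) n
  ∂-egf-b n = begin
    ιₙ (suc n) * F (suc n)
      ≡⟨ cong (ιₙ (suc n) *_) (egf-b≡sum-col {suc n} ℕ.≤-refl) ⟩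
    ιₙ (suc n) * sumℚ (suc n) (λ k → col k (suc n))
      ≡⟨ *-distribˡ-sum (suc n) (ιₙ (suc n)) _ ⟩
    sumℚ (suc n) (λ k → ∂ (col k) n)
      ≡⟨ sum-cong (suc n) (λ k _ → ∂-col≡e⊛col⁻ k n) ⟩
    sumℚ (suc n) (λ k → (e ⊛ col⁻ k) n - ι r * col k n)
      ≡⟨ sum-- (suc n) _ _ ⟩
    sumℚ (suc n) (λ k → (e ⊛ col⁻ k) n) - sumℚ (suc n) (λ k → ι r * col k n)
      ≡⟨ cong₂ _-_ shift (sym (*-distribˡ-sum (suc n) (ι r) _)) ⟩
    sumℚ n (λ k → (e ⊛ col k) n) - ι r * sumℚ (suc n) (λ k → col k n)
      ≡⟨ cong₂ (λ x y → x - ι r * y) (sum-⊛ e col n n) (sym (egf-b≡sum-col (ℕ.n≤1+n n))) ⟩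
    (e ⊛ (λ j → sumℚ n (λ k → col k j))) n - ι r * F n
      ≡⟨ cong₂ (λ x y → x - ι r * y) (⊛-congʳ e n (λ j j≤n → sym (egf-b≡sum-col j≤n)))
                                     (sym (⊛-identityˡ F n)) ⟩
    (e ⊛ F) n - ι r * (const 1ℚ ⊛ F) n
      ≡⟨ cong (λ x → (e ⊛ F) n - x) (sym (·-⊛ (ι r) (const 1ℚ) F n)) ⟩
    (e ⊛ F) n - ((ι r · const 1ℚ) ⊛ F) n
      ≡⟨ sym (⊛-distribʳ-⊖ e (ι r · const 1ℚ) F n) ⟩
    ((e ⊖ (ι r · const 1ℚ)) ⊛ F) n
      ∎
    where
    F : Series
    F = egf-b d r
    shift : sumℚ (suc n) (λ k → (e ⊛ col⁻ k) n) ≡ sumℚ n (λ k → (e ⊛ col k) n)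
    shift = trans (sum-suc n _)
      (trans (cong (_+ sumℚ n (λ k → (e ⊛ col k) n)) (⊛-zeroʳ e n)) (ℚ.+-identityˡ _))


module _ (d r : ℤ) (d≢0 : d ≢ 0ℤ) where

  private instance
    ιd-nonZero : ℚ.NonZero (ι d)
    ιd-nonZero = fromℤ-nonZero d d≢0

  G-zero : G d r d≢0 0 ≡ 0ℚ
  G-zero = solve 2 (λ x w → ((con 1ℚ :- x :* con 0ℚ) :- con 1ℚ) :* w := con 0ℚ)
                   refl (ι (d ℤ.* r)) (1/ ι d)
    where open ℚ-Solver.+-*-Solver

  ∂-G : ∀ n → ∂ (G d r d≢0) n ≡ (expLin d ⊖ (ι r · const 1ℚ)) n
  ∂-G n = begin
    ιₙ (suc n) * (H (suc n) * 1/ ι d)   ≡⟨ sym (ℚ.*-assoc (ιₙ (suc n)) (H (suc n)) (1/ ι d)) ⟩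
    ∂ H n * 1/ ι d                      ≡⟨ cong (_* 1/ ι d) ∂-H ⟩
    ι d * y * 1/ ι d                    ≡⟨ cong (_* 1/ ι d) (ℚ.*-comm (ι d) y) ⟩
    y * ι d * 1/ ι d                    ≡⟨ ℚ.*-assoc y (ι d) (1/ ι d) ⟩
    y * (ι d * 1/ ι d)                  ≡⟨ cong (y *_) (ℚ.*-inverseʳ (ι d)) ⟩
    y * 1ℚ                              ≡⟨ ℚ.*-identityʳ y ⟩
    y                                   ∎
    where
    open ℚ-Solver.+-*-Solver
    H : Series
    H = (expLin d ⊖ (ι (d ℤ.* r) · X)) ⊖ const 1ℚ
    y : ℚ
    y = (expLin d ⊖ (ι r · const 1ℚ)) n
    ∂-H : ∂ H n ≡ ι d * y
    ∂-H = begin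
      ∂ H n
        ≡⟨ trans (∂-⊖ (expLin d ⊖ (ι (d ℤ.* r) · X)) (const 1ℚ) n)
                 (cong₂ _-_ (∂-⊖ (expLin d) (ι (d ℤ.* r) · X) n) (∂-const 1ℚ n)) ⟩
      (∂ (expLin d) n - ∂ (ι (d ℤ.* r) · X) n) - 0ℚ
        ≡⟨ cong₂ (λ x y → (x - y) - 0ℚ) (∂-expLin d n)
                 (trans (∂-· (ι (d ℤ.* r)) X n) (cong₂ _*_ (ι-homo-* d r) (∂-X n))) ⟩
      (ι d * expLin d n - ι d * ι r * const 1ℚ n) - 0ℚ
        ≡⟨ solve 4 (λ D e R u → (D :* e :- D :* R :* u) :- con 0ℚ := D :* (e :- R :* u))
                   refl (ι d) (expLin d n) (ι r) (const 1ℚ n) ⟩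
      ι d * y
        ∎

proposition11p8 : (d r : ℤ) (d≢0 : d ≢ 0ℤ) (n : ℕ) →
    egf-b d r n ≡ expS (G d r d≢0) n
proposition11p8 d r d≢0 =
  ∂-unique (∂ g ⊛_) (⊛-congʳ (∂ g)) ∂-egf-b′ (∂-expS (G-zero d r d≢0)) refl
  where
  g : Series
  g = G d r d≢0
  ∂-egf-b′ : ∀ n → ∂ (egf-b d r) n ≡ (∂ g ⊛ egf-b d r) n
  ∂-egf-b′ n = trans (Triangle.∂-egf-b d r n) (⊛-congˡ (egf-b d r) n (λ i _ → sym (∂-G d r d≢0 i)))
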